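{- Let $x,y\in V$ be an independent pair and let $C\in\mathcal{C}_x$. If $C$ is not fully-$y$-sensitive (i.e., $C\in\mathcal{C}_x\setminus\mathcal{FS}(x,y)$), then $C$ is connected to $s$ by a path in $G\setminus\{x,y\}$ that avoids all components in $\mathcal{FS}(x,y)\cup\mathcal{FS}(y,x)$.
   Context: $G=(V,E)$ is a connected graph with no cut vertex and $T$ is a BFS tree of $G$ rooted at $s$; $\pi(u,v)$ denotes the $T$-path between $u,v$ and $\circ$ concatenation. For $x\in V$, $T_x$ is the subtree rooted at $x$, $V_x=V(T_x)\setminus\{x\}$, $\mathcal{C}_x$ is the set of connected components of the induced graph $G[V_x]$, and for $v\in V_x$, $C_{x,v}$ is the component of $\mathcal{C}_x$ containing $v$. For every $x$ and every $C\in\mathcal{C}_x$ a fixed edge $(u_C,v_C)\in E$ with $v_C\in C$ and $u_C\in V\setminus V(T_x)$ is chosen, and $\pi_x(s,C)=\pi(s,u_C)\circ(u_C,v_C)$. A pair $x,y$ is independent if neither is a $T$-ancestor of the other. For an independent pair $x,y$: $C\in\mathcal{C}_x$ is $y$-sensitive if $y\in\pi_x(s,C)$; it is pseudo-$y$-sensitive if $\pi_x(s,C)$ contains a $T$-edge $(y,y')$ (with $y'$ a child of $y$) such that $x\notin\pi_y(s,C_{y,y'})$; it is fully-$y$-sensitive if it is $y$-sensitive but not pseudo-$y$-sensitive. $\mathcal{FS}(x,y)\subseteq\mathcal{C}_x$ denotes the set of fully-$y$-sensitive components of $\mathcal{C}_x$ (and $\mathcal{FS}(y,x)\subseteq\mathcal{C}_y$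 symmetrically). -}

module Defs where

open import Data.Nat using (ℕ; zero; suc; _≤_)
open import Data.Fin using (Fin)
open import Data.Product using (Σ; ∃; _×_; _,_)
open import Data.Sum using (_⊎_)
open import Data.Unit using (⊤)
open import Relation.Nullary using (¬_)
open import Relation.Binary.PropositionalEquality using (_≡_; _≢_)

record Graph : Set₁ where
  field
    n      : ℕ
    Adj    : Fin n → Fin n → Set
    sym    : ∀ {u v} → Adj u v → Adj v u
    irrefl : ∀ {u} → ¬ Adj u u

module _ (G : Graph) where
  open Graph G

  data WalkIn (P : Fin n → Set) : Fin n → Fin n → Set where
    [_]    : ∀ {v} → P v → WalkIn P v v
    _∷⟨_⟩_ : ∀ {u v w} → P u → Adj u v → WalkIn P v w → WalkIn P u w

  walkLength : ∀ {P u v} → WalkIn P u v → ℕ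
  walkLength [ _ ]         = zero
  walkLength (_ ∷⟨ _ ⟩ w) = suc (walkLength w)

  Connected : Set
  Connected = ∀ u v → WalkIn (λ _ → ⊤) u v

  NoCutVertex : Set
  NoCutVertex = ∀ z u v → u ≢ z → v ≢ z → WalkIn (λ w → w ≢ z) u v

  record BFSTree : Set where
    field
      root         : Fin n
      parent       : Fin n → Fin n
      depth        : Fin n → ℕ
      parent-root  : parent root ≡ root
      depth-root   : depth root ≡ 0
      tree-edge    : ∀ v → v ≢ root → Adj (parent v) v
      depth-parent : ∀ v → v ≢ root → depth v ≡ suc (depth (parent v))
      shortest     : ∀ v (w : WalkIn (λ _ → ⊤) root v) → depth v ≤ walkLength w

  module _ (T : BFSTree) where
    open BFSTree T

    parentIter : ℕ → Fin n → Fin n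
    parentIter zero    v = v
    parentIter (suc k) v = parentIter k (parent v)

    -- Anc a v : a is a T-ancestor of v (reflexively), i.e. v ∈ V(T_a);
    -- equivalently a lies on the T-path π(s,v).
    Anc : Fin n → Fin n → Set
    Anc a v = ∃ λ k → parentIter k v ≡ a

    InV : Fin n → Fin n → Set
    InV x v = Anc x v × v ≢ x

    Independent : Fin n → Fin n → Set
    Independent x y = ¬ Anc x y × ¬ Anc y x

    SameComp : Fin n → Fin n → Fin n → Set
    SameComp x v = WalkIn (InV x) v

    -- A component is named by any of its vertices v (C = C_{x,v});
    -- the choice must not depend on the representative.
    -- (Required for x ≠ s only: for x = s no such edge exists, and the
    --  lemma only uses the choice for members of an independent pair.)
    record EdgeChoice : Set where
      field
        uC   : Fin n → Fin n → Fin n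
        vC   : Fin n → Fin n → Fin n
        vC-in  : ∀ x v → x ≢ root → InV x v → SameComp x v (vC x v)
        uC-out : ∀ x v → x ≢ root → InV x v → ¬ Anc x (uC x v)
        edge   : ∀ x v → x ≢ root → InV x v → Adj (uC x v) (vC x v)
        uC-wd  : ∀ x v w → x ≢ root → InV x v → SameComp x v w → uC x v ≡ uC x w
        vC-wd  : ∀ x v w → x ≢ root → InV x v → SameComp x v w → vC x v ≡ vC x w

    module _ (ch : EdgeChoice) where
      open EdgeChoice ch

      -- w is a vertex of π_x(s, C_{x,v}) = π(s, u_C) ∘ (u_C , v_C)
      OnPath : Fin n → Fin n → Fin n → Set
      OnPath x v w = Anc w (uC x v) ⊎ w ≡ vC x v

      UEq : Fin n → Fin n → Fin n → Fin n → Set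
      UEq a b c d = (a ≡ c × b ≡ d) ⊎ (a ≡ d × b ≡ c)

      EdgeOnPath : Fin n → Fin n → Fin n → Fin n → Set
      EdgeOnPath x v a b =
        (∃ λ w → Anc w (uC x v) × w ≢ root × UEq a b (parent w) w)
        ⊎ UEq a b (uC x v) (vC x v)

      TEdge : Fin n → Fin n → Set
      TEdge y y' = y' ≢ root × parent y' ≡ y

      Sensitive : Fin n → Fin n → Fin n → Set
      Sensitive x y v = OnPath x v y

      PseudoSensitive : Fin n → Fin n → Fin n → Set
      PseudoSensitive x y v =
        ∃ λ y' → TEdge y y' × EdgeOnPath x v y y' × ¬ OnPath y y' x

      FullySensitive : Fin n → Fin n → Fin n → Set
      FullySensitive x y v = Sensitive x y v × ¬ PseudoSensitive x y v

      InFS : Fin n → Fin n → Fin n → Set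
      InFS x y w = InV x w × FullySensitive x y w

{-# OPTIONS --safe #-}
module Submission where

-- Walk back along π_x(s, C) from the chosen edge (u_C, v_C). If C is not y-sensitive, the T-path
-- from u_C up to s meets neither T_x nor T_y, so it avoids x, y and every component to be avoided.
-- Otherwise C, being y-sensitive but not fully so, is pseudo-y-sensitive through a T-edge (y, y′)
-- whose component C′ = C_{y,y′} is not x-sensitive. Then u_C lies below y′, so the path crosses C′
-- from u_C to its own chosen edge (u_{C′}, v_{C′}) and climbs from u_{C′} to s. The components C
-- and C′ are harmless because neither is fully sensitive, and the two climbs because neither x nor
-- y is an ancestor of where they start.

open import Defs
open import Data.Fin using (Fin; _≟_)
open import Data.Fin.Properties using (any?)
open import Data.Nat using (ℕ; zero; suc; _+_; _≤_; s≤s⁻¹)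
open import Data.Nat.Properties using (≤-refl; ≤-trans; n≤1+n; n≤0⇒n≡0; <-irrefl)
open import Data.Product using (∃; _×_; _,_; proj₁; proj₂; swap)
open import Data.Sum using (_⊎_; inj₁; inj₂)
open import Data.Empty using (⊥; ⊥-elim)
open import Relation.Nullary using (¬_; Dec; yes; no)
open import Relation.Nullary.Decidable using (_×-dec_; _⊎-dec_; ¬?)
open import Relation.Binary.PropositionalEquality using (_≡_; _≢_; refl; sym; trans; cong; subst)

module Walks (G : Graph) where
  open Graph G renaming (sym to Adj-sym)

  walk-start : ∀ {P u v} → WalkIn G P u v → P u
  walk-start [ p ]        = p
  walk-start (p ∷⟨ _ ⟩ _) = p

  walk-end : ∀ {P u v} → WalkIn G P u v → P v
  walk-end [ p ]        = p
  walk-end (_ ∷⟨ _ ⟩ w) = walk-end w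

  _++_ : ∀ {P u v w} → WalkIn G P u v → WalkIn G P v w → WalkIn G P u w
  [ _ ]        ++ w′ = w′
  (p ∷⟨ e ⟩ w) ++ w′ = p ∷⟨ e ⟩ (w ++ w′)

  _∷ʳ⟨_⟩_ : ∀ {P u v w} → WalkIn G P u v → Adj v w → P w → WalkIn G P u w
  w ∷ʳ⟨ e ⟩ p = w ++ (walk-end w ∷⟨ e ⟩ [ p ])

  reverse : ∀ {P u v} → WalkIn G P u v → WalkIn G P v u
  reverse [ p ]        = [ p ]
  reverse (p ∷⟨ e ⟩ w) = reverse w ∷ʳ⟨ Adj-sym e ⟩ p

  map : ∀ {P Q : Fin n → Set} {u v} → (∀ z → P z → Q z) → WalkIn G P u v → WalkIn G Q u v
  map f ([_] {v} p)         = [ f v p ]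
  map f (_∷⟨_⟩_ {u} p e w) = f u p ∷⟨ e ⟩ map f w

  reachableAlong : ∀ {P r u v} → WalkIn G P r u → WalkIn G P u v → WalkIn G (WalkIn G P r) u v
  reachableAlong pre [ _ ]        = [ pre ]
  reachableAlong pre (_ ∷⟨ e ⟩ w) = pre ∷⟨ e ⟩ reachableAlong (pre ∷ʳ⟨ e ⟩ walk-start w) w

module Ancestry (G : Graph) (T : BFSTree G) where
  open Graph G renaming (sym to Adj-sym)
  open BFSTree T

  infix 4 _≼_
  _≼_ : Fin n → Fin n → Set
  _≼_ = Anc G T

  ↑ : ℕ → Fin n → Fin n
  ↑ = parentIter G T

  ≼-refl : ∀ {a} → a ≼ a
  ≼-refl = 0 , refl

  parentIter-+ : ∀ i j w → ↑ (i + j) w ≡ ↑ j (↑ i w)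
  parentIter-+ zero    j w = refl
  parentIter-+ (suc i) j w = parentIter-+ i j (parent w)

  ≼-trans : ∀ {a b c} → a ≼ b → b ≼ c → a ≼ c
  ≼-trans {c = c} (i , refl) (j , refl) = j + i , parentIter-+ j i c

  parent-≼ : ∀ v → parent v ≼ v
  parent-≼ v = 1 , refl

  parentIter-root : ∀ k → ↑ k root ≡ root
  parentIter-root zero    = refl
  parentIter-root (suc k) rewrite parent-root = parentIter-root k

  ≼-root⇒≡root : ∀ {a} → a ≼ root → a ≡ root
  ≼-root⇒≡root (k , refl) = parentIter-root k

  depth≡0⇒≡root : ∀ v → depth v ≡ 0 → v ≡ root
  depth≡0⇒≡root v d≡0 with v ≟ root
  ... | yes v≡r = v≡r
  ... | no  v≢r with () ← trans (sym (depth-parent v v≢r)) d≡0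

  parentIter-depth : ∀ k w → depth w ≤ k → ↑ k w ≡ root
  parentIter-depth zero    w d≤0 = depth≡0⇒≡root w (n≤0⇒n≡0 d≤0)
  parentIter-depth (suc k) w d≤k with w ≟ root
  ... | yes refl = parentIter-root (suc k)
  ... | no  w≢r  = parentIter-depth k (parent w) (s≤s⁻¹ (subst (_≤ suc k) (depth-parent w w≢r) d≤k))

  root-≼ : ∀ w → root ≼ w
  root-≼ w = depth w , parentIter-depth (depth w) w ≤-refl

  depth-parent-≤ : ∀ v → depth (parent v) ≤ depth v
  depth-parent-≤ v with v ≟ root
  ... | yes refl rewrite parent-root = ≤-refl
  ... | no  v≢r  rewrite depth-parent v v≢r = n≤1+n _

  depth-mono-≼ : ∀ {a v} → a ≼ v → depth a ≤ depth v
  depth-mono-≼ (zero  , refl) = ≤-refl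
  depth-mono-≼ {v = v} (suc k , e) = ≤-trans (depth-mono-≼ (k , e)) (depth-parent-≤ v)

  child-⋠-parent : ∀ c → c ≢ root → ¬ c ≼ parent c
  child-⋠-parent c c≢r c≼p = <-irrefl refl
    (subst (_≤ depth (parent c)) (depth-parent c c≢r) (depth-mono-≼ c≼p))

  parentIter-comparable : ∀ i j w → ↑ i w ≼ ↑ j w ⊎ ↑ j w ≼ ↑ i w
  parentIter-comparable zero    j       w = inj₂ (j , refl)
  parentIter-comparable (suc i) zero    w = inj₁ (suc i , refl)
  parentIter-comparable (suc i) (suc j) w = parentIter-comparable i j (parent w)

  ≼-comparable : ∀ {a b w} → a ≼ w → b ≼ w → a ≼ b ⊎ b ≼ a
  ≼-comparable {w = w} (i , refl) (j , refl) = parentIter-comparable i j w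

  independent⇒no-common-descendant : ∀ {x y w} → Independent G T x y → x ≼ w → y ≼ w → ⊥
  independent⇒no-common-descendant (x⋠y , y⋠x) x≼w y≼w with ≼-comparable x≼w y≼w
  ... | inj₁ x≼y = x⋠y x≼y
  ... | inj₂ y≼x = y⋠x y≼x

  ⋠⇒≢root : ∀ {a v} → ¬ a ≼ v → a ≢ root
  ⋠⇒≢root {v = v} a⋠v refl = a⋠v (root-≼ v)

  _≼?_ : ∀ a w → Dec (a ≼ w)
  a ≼? w = search (depth w) w ≤-refl
    where
    search : ∀ k w → depth w ≤ k → Dec (a ≼ w)
    search k w d≤k with w ≟ a
    ... | yes refl = yes ≼-refl
    ... | no  w≢a with w ≟ root
    ...   | yes refl = no λ a≼r → w≢a (sym (≼-root⇒≡root a≼r))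
    search zero w d≤0 | no w≢a | no w≢r = ⊥-elim (w≢r (depth≡0⇒≡root w (n≤0⇒n≡0 d≤0)))
    search (suc k) w d≤k | no w≢a | no w≢r
      with search k (parent w) (s≤s⁻¹ (subst (_≤ suc k) (depth-parent w w≢r) d≤k))
    ... | yes (i , e) = yes (suc i , e)
    ... | no  a⋠p     = no λ where
      (zero  , e) → w≢a e
      (suc i , e) → a⋠p (i , e)

  ascend : ∀ {P a u} → a ≼ u → (∀ z → z ≼ u → a ≼ z → P z) → WalkIn G P u a
  ascend {P} {u = u} (k , refl) = go k u
    where
    go : ∀ k u → (∀ z → z ≼ u → ↑ k u ≼ z → P z) → WalkIn G P u (↑ k u)
    go zero    u onPath = [ onPath u ≼-refl ≼-refl ]
    go (suc k) u onPath with u ≟ root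
    ... | yes refl = subst (WalkIn G P root) (sym (parentIter-root (suc k))) [ onPath root ≼-refl (suc k , refl) ]
    ... | no  u≢r  = onPath u ≼-refl (suc k , refl) ∷⟨ Adj-sym (tree-edge u u≢r) ⟩
                     go k (parent u) λ z z≼p a≼z → onPath z (≼-trans z≼p (parent-≼ u)) a≼z

module Routing (G : Graph) (T : BFSTree G) (ch : EdgeChoice G T) where
  open Graph G renaming (sym to Adj-sym)
  open BFSTree T
  open EdgeChoice ch
  open Walks G
  open Ancestry G T

  Avoids : Fin n → Fin n → Fin n → Set
  Avoids x y w = w ≢ x × w ≢ y × ¬ InFS G T ch x y w × ¬ InFS G T ch y x w

  avoids-swap : ∀ {x y w} → Avoids x y w → Avoids y x w
  avoids-swap (w≢x , w≢y , ∉x , ∉y) = w≢y , w≢x , ∉y , ∉x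

  fullySensitive-resp-component : ∀ {x y v w} → x ≢ root → InV G T x v → SameComp G T x v w →
    FullySensitive G T ch x y w → FullySensitive G T ch x y v
  fullySensitive-resp-component {x} {v = v} {w} x≢r v∈Vx w∈C fs
    rewrite uC-wd x v w x≢r v∈Vx w∈C | vC-wd x v w x≢r v∈Vx w∈C = fs

  ancestor-avoids : ∀ {x y u z} → ¬ x ≼ u → ¬ y ≼ u → z ≼ u → Avoids x y z
  ancestor-avoids x⋠u y⋠u z≼u =
    (λ { refl → x⋠u z≼u }) ,
    (λ { refl → y⋠u z≼u }) ,
    (λ (z∈Vx , _) → x⋠u (≼-trans (proj₁ z∈Vx) z≼u)) ,
    (λ (z∈Vy , _) → y⋠u (≼-trans (proj₁ z∈Vy) z≼u))

  path-to-root : ∀ {x y u} → ¬ x ≼ u → ¬ y ≼ u → WalkIn G (Avoids x y) u root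
  path-to-root x⋠u y⋠u = ascend (root-≼ _) λ z z≼u _ → ancestor-avoids x⋠u y⋠u z≼u

  component-avoids : ∀ {x y v w} → Independent G T x y → InV G T x v →
    ¬ FullySensitive G T ch x y v → SameComp G T x v w → Avoids x y w
  component-avoids ind v∈Vx ¬fs w∈C =
    proj₂ w∈Vx ,
    (λ { refl → proj₁ ind (proj₁ w∈Vx) }) ,
    (λ (_ , fs) → ¬fs (fullySensitive-resp-component x≢r v∈Vx w∈C fs)) ,
    (λ (w∈Vy , _) → independent⇒no-common-descendant ind (proj₁ w∈Vx) (proj₁ w∈Vy))
    where
    x≢r = ⋠⇒≢root (proj₁ ind)
    w∈Vx = walk-end w∈C

  onPath? : ∀ x v w → Dec (OnPath G T ch x v w)
  onPath? x v w = (w ≼? uC x v) ⊎-dec (w ≟ vC x v)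

  uEq? : ∀ a b c d → Dec (UEq G T ch a b c d)
  uEq? a b c d = ((a ≟ c) ×-dec (b ≟ d)) ⊎-dec ((a ≟ d) ×-dec (b ≟ c))

  edgeOnPath? : ∀ x v a b → Dec (EdgeOnPath G T ch x v a b)
  edgeOnPath? x v a b =
    any? (λ w → (w ≼? uC x v) ×-dec ¬? (w ≟ root) ×-dec uEq? a b (parent w) w)
    ⊎-dec uEq? a b (uC x v) (vC x v)

  pseudoSensitive? : ∀ x y v → Dec (PseudoSensitive G T ch x y v)
  pseudoSensitive? x y v = any? λ y′ →
    (¬? (y′ ≟ root) ×-dec (parent y′ ≟ y)) ×-dec edgeOnPath? x v y y′ ×-dec ¬? (onPath? y y′ x)

  child-subtree-⊆V : ∀ {y y′ z} → TEdge G T ch y y′ → y′ ≼ z → InV G T y z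
  child-subtree-⊆V {y′ = y′} (y′≢r , refl) y′≼z =
    ≼-trans (parent-≼ y′) y′≼z , λ { refl → child-⋠-parent y′ y′≢r y′≼z }

  ≼-entry : ∀ {x v} → x ≢ root → InV G T x v → x ≼ vC x v
  ≼-entry x≢r v∈Vx = proj₁ (walk-end (vC-in _ _ x≢r v∈Vx))

  -- The edge (y, y′) on π_x(s, C) cannot be the last edge, since it would put a vertex of V_x into V_y
  -- or y into V_x; so it is a T-edge of π(s, u_C) and y′ is an ancestor of u_C.
  child-≼-exit : ∀ {x y v y′} → Independent G T x y → InV G T x v → TEdge G T ch y y′ →
    EdgeOnPath G T ch x v y y′ → y′ ≼ uC x v
  child-≼-exit _ _ _ (inj₁ (w , w≼u , _ , inj₁ (_ , refl))) = w≼u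
  child-≼-exit {y′ = y′} _ _ (y′≢r , py′≡y) (inj₁ (w , _ , _ , inj₂ (refl , y′≡pw))) =
    ⊥-elim (child-⋠-parent y′ y′≢r (1 , trans (cong parent py′≡y) (sym y′≡pw)))
  child-≼-exit ind v∈Vx (_ , py′≡y) (inj₂ (inj₁ (_ , refl))) =
    ⊥-elim (independent⇒no-common-descendant ind (≼-entry (⋠⇒≢root (proj₁ ind)) v∈Vx) (1 , py′≡y))
  child-≼-exit ind v∈Vx _ (inj₂ (inj₂ (refl , _))) =
    ⊥-elim (proj₁ ind (≼-entry (⋠⇒≢root (proj₁ ind)) v∈Vx))

  pseudo-exit-path : ∀ {x y v} → Independent G T x y → InV G T x v →
    PseudoSensitive G T ch x y v → WalkIn G (Avoids x y) (uC x v) root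
  pseudo-exit-path {x} {y} {v} ind v∈Vx (y′ , y′-child , yy′∈π , x∉π′) =
    map C′-avoids through-C′ ++
      (C′-avoids _ (walk-end through-C′) ∷⟨ Adj-sym (edge y y′ y≢r y′∈Vy) ⟩
        path-to-root (λ x≼u′ → x∉π′ (inj₁ x≼u′)) (uC-out y y′ y≢r y′∈Vy))
    where
    y≢r = ⋠⇒≢root (proj₂ ind)
    y′∈Vy = child-subtree-⊆V y′-child ≼-refl

    climb : WalkIn G (InV G T y) (uC x v) y′
    climb = ascend (child-≼-exit ind v∈Vx y′-child yy′∈π) λ z _ y′≼z → child-subtree-⊆V y′-child y′≼z

    through-C′ : WalkIn G (SameComp G T y y′) (uC x v) (vC y y′)
    through-C′ = reachableAlong (reverse climb) (climb ++ vC-in y y′ y≢r y′∈Vy)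

    C′-avoids : ∀ z → SameComp G T y y′ z → Avoids x y z
    C′-avoids z z∈C′ = avoids-swap (component-avoids (swap ind) y′∈Vy (λ fs → x∉π′ (proj₁ fs)) z∈C′)

  exit-path : ∀ {x y v} → Independent G T x y → InV G T x v → ¬ FullySensitive G T ch x y v →
    WalkIn G (Avoids x y) (uC x v) root
  exit-path {x} {y} {v} ind v∈Vx ¬fs with pseudoSensitive? x y v
  ... | yes ps = pseudo-exit-path ind v∈Vx ps
  ... | no ¬ps = path-to-root (uC-out x v (⋠⇒≢root (proj₁ ind)) v∈Vx) λ y≼u → ¬fs (inj₁ y≼u , ¬ps)

-- Connectivity and the absence of cut vertices are part of the setting only: the path is built
-- from T and the chosen edges alone.
lemma4p5 : (G : Graph) → Connected G → NoCutVertex G →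
    (T : BFSTree G) → (ch : EdgeChoice G T) →
    (x y : Fin (Graph.n G)) → Independent G T x y →
    (v : Fin (Graph.n G)) → InV G T x v →
    ¬ FullySensitive G T ch x y v →
    ∃ λ u → SameComp G T x v u ×
      WalkIn G (λ w → w ≢ x × w ≢ y × ¬ InFS G T ch x y w × ¬ InFS G T ch y x w)
        u (BFSTree.root T)
lemma4p5 G _ _ T ch x y ind v v∈Vx ¬fs =
  vC x v , entry ,
  component-avoids ind v∈Vx ¬fs entry ∷⟨ Adj-sym (edge x v x≢r v∈Vx) ⟩ exit-path ind v∈Vx ¬fs
  where
  open Graph G renaming (sym to Adj-sym)
  open EdgeChoice ch
  open Ancestry G T
  open Routing G T ch
  x≢r = ⋠⇒≢root (proj₁ ind)
  entry = vC-in x v x≢r v∈Vx
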